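{- For a triangular partition $\tau=\tau_1\tau_2$ with exactly two parts, the number of triangular Young tableaux of shape $\tau$ is $$\frac{\tau_1-2\tau_2+2}{\tau_1+2}\binom{\tau_1+\tau_2+1}{\tau_2}.$$
   Context: $\mathbb{N}$ denotes the positive integers. A partition $\lambda=\lambda_1\dots\lambda_k$ of $n=\sum\lambda_i$ is identified with its Ferrers diagram $\{(a,b)\in\mathbb{N}^2:1\le b\le k,\,1\le a\le\lambda_b\}$ (points called cells). A partition is triangular if there are real $r,s>0$ such that it is exactly the set of points of $\mathbb{N}^2$ on or below the line $x/r+y/s=1$. For a triangular partition $\tau$ of size $n$, a triangular Young tableau of shape $\tau$ is a bijective filling of the cells of $\tau$ with $1,2,\dots,n$ such that for every $i\in\{1,\dots,n\}$, the set of cells with labels at most $i$ is the Ferrers diagram of a triangular partition.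
   Formalization: The parameters r, s defining triangular partitions, for the shape τ and for every shape formed by the cells with labels at most i, range over positive rationals instead of positive reals. -}

module Defs where

open import Data.Nat using (ℕ; zero; suc; _≤_)
open import Data.Nat.Combinatorics using (_C_)
open import Data.Integer as ℤ using (ℤ; +_)
open import Data.Rational as ℚ using (ℚ; _/_)
open import Data.List using (List; []; _∷_; length; take)
open import Data.Nat.ListAction using (sum)
open import Data.List.Relation.Unary.All using (All)
open import Data.List.Relation.Unary.Linked using (Linked)
open import Data.List.Relation.Unary.Unique.Propositional using (Unique)
open import Data.List.Membership.Propositional using (_∈_)
open import Data.Product using (Σ; _×_; _,_)
open import Function.Bundles using (_⇔_)
open import Relation.Binary.PropositionalEquality using (_≡_)

IsPartition : List ℕ → Set
IsPartition λs = All (1 ≤_) λs × Linked (λ x y → y ≤ x) λs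

-- row λ b = λ_b (1-indexed), and 0 if b is out of range.
row : List ℕ → ℕ → ℕ
row []       _             = 0
row (x ∷ xs) zero          = 0
row (x ∷ xs) (suc zero)    = x
row (x ∷ xs) (suc (suc b)) = row xs (suc b)

InDiagram : List ℕ → ℕ × ℕ → Set
InDiagram λs (a , b) = (1 ≤ a) × (1 ≤ b) × (b ≤ length λs) × (a ≤ row λs b)

ℕ→ℚ : ℕ → ℚ
ℕ→ℚ n = + n / 1

-- λ is triangular: there are r , s > 0 such that the diagram is exactly the set of
-- points (a , b) of N² with a/r + b/s ≤ 1, written (multiplying by r s > 0)
-- as a s + b r ≤ r s.  (r , s range over ℚ.)
Triangular : List ℕ → Set
Triangular λs =
  Σ ℚ λ r → Σ ℚ λ s → (ℚ.0ℚ ℚ.< r) × (ℚ.0ℚ ℚ.< s) ×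
    (∀ a b → 1 ≤ a → 1 ≤ b →
      (InDiagram λs (a , b) ⇔
        ((ℕ→ℚ a ℚ.* s) ℚ.+ (ℕ→ℚ b ℚ.* r) ℚ.≤ r ℚ.* s)))

IsTriangularPartition : List ℕ → Set
IsTriangularPartition λs = IsPartition λs × Triangular λs

-- A triangular Young tableau of shape τ (of size n) is encoded as the list
-- cs = c₁ c₂ … cₙ where cᵢ is the cell carrying the label i.
IsTriangularTableau : List ℕ → List (ℕ × ℕ) → Set
IsTriangularTableau τ cs =
  length cs ≡ sum τ ×
  Unique cs ×
  (∀ c → (c ∈ cs) ⇔ InDiagram τ c) ×
  (∀ i → 1 ≤ i → i ≤ sum τ →
    Σ (List ℕ) λ μ → IsTriangularPartition μ ×
      (∀ c → (c ∈ take i cs) ⇔ InDiagram μ c))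

{-# OPTIONS --safe #-}
-- A two-row shape (x, y) is triangular exactly when 2 y ≤ x + 1: a line leaving (y, 2) below it and
-- (x + 1, 1), (1, 3) above it forces this, and conversely, writing x = y + t, the half-plane
-- 2 a + (2 t + 1) b ≤ 2 (y + 2 t + 1) cuts out the shape.  Every prefix of a triangular tableau is then a
-- two-row shape whose last cell ends a row, so the tableaux of shape (x, y) are the lattice paths from
-- (0, 0) to (x, y) through shapes with 2 y ≤ x + 1.  Their number obeys Pascal's rule inside this region
-- and vanishes just outside it, at x = 2 y − 2; so does C(x + y + 1, y) − 2 C(x + y + 1, y − 1), and the
-- absorption identity (k + 1) C(m + k, k + 1) = m C(m + k, k) rewrites this as the closed form.
module Submission where

open import Defs
open import Data.Nat using (ℕ; _≤_)
open import Data.Nat as ℕ using (zero; suc; _+_; _*_; _<_; z≤n; s≤s; s≤s⁻¹)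
import Data.Nat.Properties as ℕ
open import Data.Nat.ListAction using (sum)
open import Data.Nat.Combinatorics using (_C_; nC1≡n; nCk+nC[k+1]≡[n+1]C[k+1])
open import Data.Nat.Tactic.RingSolver using (solve-∀; solve)
import Data.Nat.Coprimality as Coprime
open import Data.Integer as ℤ using (ℤ; +_)
import Data.Integer.Properties as ℤ
import Data.Integer.Tactic.RingSolver as ℤ-Solver
open import Data.Rational as ℚ using (ℚ; mkℚ; 0ℚ)
import Data.Rational.Properties as ℚ
import Data.Rational.Unnormalised as ℚᵘ
import Data.Rational.Unnormalised.Properties as ℚᵘ
open import Data.Rational.Solver using () renaming (module +-*-Solver to ℚ-Solver)
open import Data.List using (List; []; _∷_; length; take; _++_; _∷ʳ_; map)
import Data.List.Properties as List
open import Data.List.Reverse using (Reverse; reverseView; []; _∶_∶ʳ_)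
open import Data.List.Membership.Propositional using (_∈_; _∉_)
open import Data.List.Membership.Propositional.Properties using (∈-++⁺ˡ; ∈-++⁺ʳ; ∈-++⁻; ∈-map⁺; ∈-map⁻; ∈-length)
open import Data.List.Relation.Unary.Any using (here; there)
open import Data.List.Relation.Unary.All as All using (All)
import Data.List.Relation.Unary.All.Properties as All
open import Data.List.Relation.Unary.AllPairs as AllPairs using ()
open import Data.List.Relation.Unary.Linked using (Linked)
open import Data.List.Relation.Unary.Unique.Propositional using (Unique)
import Data.List.Relation.Unary.Unique.Propositional.Properties as Unique
open import Data.List.Relation.Binary.Disjoint.Propositional using (Disjoint)
open import Data.Product using (Σ; _×_; _,_; proj₁; proj₂)
open import Data.Sum as Sum using (_⊎_; inj₁; inj₂; [_,_])
open import Data.Sum.Function.Propositional using (_⊎-⇔_)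
open import Data.Empty using (⊥-elim)
open import Function.Base using (_∘_; case_of_)
open import Function.Bundles using (_⇔_; mk⇔; Equivalence)
open import Function.Construct.Identity using (⇔-id)
open import Function.Construct.Composition using (_⇔-∘_)
open import Function.Construct.Symmetry using (⇔-sym)
open import Relation.Nullary using (¬_; yes; no; contradiction)
open import Relation.Binary.PropositionalEquality
  using (_≡_; _≢_; refl; sym; trans; cong; cong₂; subst; subst₂; module ≡-Reasoning)
open Equivalence using (to; from)

-- Regions under a line with positive intercepts

-- ℕ→ℚ n = + n / 1 normalises through a gcd and is stuck for a variable n; ι n is the same
-- rational written directly in normal form.
ι : ℕ → ℚ
ι n = mkℚ (+ n) 0 (Coprime.sym (Coprime.1-coprimeTo n))

ℕ→ℚ≡ι : ∀ n → ℕ→ℚ n ≡ ι n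
ℕ→ℚ≡ι n = ℚ.↥p/↧p≡p (ι n)

ι-+ : ∀ m n → ι (m + n) ≡ ι m ℚ.+ ι n
ι-+ m n = ℚ.toℚᵘ-injective
  (ℚᵘ.≃-trans (ℚᵘ.*≡* (cong (ℤ._* + 1) numerators)) (ℚᵘ.≃-sym (ℚ.toℚᵘ-homo-+ (ι m) (ι n))))
  where
  numerators : + (m + n) ≡ + m ℤ.* + 1 ℤ.+ + n ℤ.* + 1
  numerators = sym (cong₂ ℤ._+_ (ℤ.*-identityʳ (+ m)) (ℤ.*-identityʳ (+ n)))

ι-* : ∀ m n → ι (m * n) ≡ ι m ℚ.* ι n
ι-* m n = ℚ.toℚᵘ-injective
  (ℚᵘ.≃-trans (ℚᵘ.*≡* (cong (ℤ._* + 1) (ℤ.pos-* m n))) (ℚᵘ.≃-sym (ℚ.toℚᵘ-homo-* (ι m) (ι n))))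

ι-mono-≤ : ∀ {m n} → m ≤ n → ι m ℚ.≤ ι n
ι-mono-≤ {m} {n} m≤n = ℚ.*≤* (subst₂ ℤ._≤_ (sym (ℤ.*-identityʳ (+ m))) (sym (ℤ.*-identityʳ (+ n))) (ℤ.+≤+ m≤n))

ι-cancel-≤ : ∀ {m n} → ι m ℚ.≤ ι n → m ≤ n
ι-cancel-≤ {m} {n} (ℚ.*≤* le) = ℤ.drop‿+≤+ (subst₂ ℤ._≤_ (ℤ.*-identityʳ (+ m)) (ℤ.*-identityʳ (+ n)) le)

UnderLine : ℚ → ℚ → ℕ → ℕ → Set
UnderLine r s a b = ℕ→ℚ a ℚ.* s ℚ.+ ℕ→ℚ b ℚ.* r ℚ.≤ r ℚ.* s

-- Triangular μ is BelowLine (λ a b → InDiagram μ (a , b)) by definition.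
BelowLine : (ℕ → ℕ → Set) → Set
BelowLine R = Σ ℚ λ r → Σ ℚ λ s → 0ℚ ℚ.< r × 0ℚ ℚ.< s ×
  (∀ a b → 1 ≤ a → 1 ≤ b → R a b ⇔ UnderLine r s a b)

underLine⇔ι : ∀ r s a b → UnderLine r s a b ⇔ (ι a ℚ.* s ℚ.+ ι b ℚ.* r ℚ.≤ r ℚ.* s)
underLine⇔ι r s a b rewrite ℕ→ℚ≡ι a | ℕ→ℚ≡ι b = ⇔-id _

belowLine-cong : ∀ {R S} → (∀ a b → 1 ≤ a → 1 ≤ b → R a b ⇔ S a b) → BelowLine R → BelowLine S
belowLine-cong R⇔S (r , s , 0<r , 0<s , line) =
  r , s , 0<r , 0<s , λ a b 1≤a 1≤b → line a b 1≤a 1≤b ⇔-∘ ⇔-sym (R⇔S a b 1≤a 1≤b)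

-- Adding the two strict inequalities gives (x + 2) s + 4 r > 2 r s ≥ 2 y s + 4 r.
underLine⇒2y≤1+x : ∀ {r s} x y → 0ℚ ℚ.< s → UnderLine r s y 2 → ¬ UnderLine r s 1 3 → ¬ UnderLine r s (suc x) 1 →
                   2 * y ≤ suc x
underLine⇒2y≤1+x {r} {s} x y 0<s y2 ¬13 ¬x1 = ℕ.≮⇒≥ λ 1+x<2y → ℚ.<-irrefl refl (2rs<2rs 1+x<2y)
  where
  open ℚ.≤-Reasoning
  open ℚ-Solver using (_:+_; _:*_; _:=_; con)
  instance
    _ = ℚ.pos⇒nonNeg s {{ℚ.positive 0<s}}
  regroup : ∀ u v w → (u ℚ.* s ℚ.+ v ℚ.* r) ℚ.+ (w ℚ.* s ℚ.+ u ℚ.* r) ≡ (u ℚ.+ w) ℚ.* s ℚ.+ (v ℚ.+ u) ℚ.* r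
  regroup u v w = ℚ-Solver.solve 5
    (λ u v w r s → (u :* s :+ v :* r) :+ (w :* s :+ u :* r) := (u :+ w) :* s :+ (v :+ u) :* r) refl u v w r s
  factor : ∀ t u → (t ℚ.* u) ℚ.* s ℚ.+ (t ℚ.* t) ℚ.* r ≡ t ℚ.* (u ℚ.* s ℚ.+ t ℚ.* r)
  factor t u = ℚ-Solver.solve 4 (λ t u r s → (t :* u) :* s :+ (t :* t) :* r := t :* (u :* s :+ t :* r)) refl t u r s
  double : ∀ q → ι 2 ℚ.* q ≡ q ℚ.+ q
  double q = ℚ-Solver.solve 1 (λ q → con (ι 2) :* q := q :+ q) refl q
  2rs<2rs : suc x < 2 * y → r ℚ.* s ℚ.+ r ℚ.* s ℚ.< r ℚ.* s ℚ.+ r ℚ.* s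
  2rs<2rs 1+x<2y = begin-strict
    r ℚ.* s ℚ.+ r ℚ.* s
      <⟨ ℚ.+-mono-< (ℚ.≰⇒> (¬13 ∘ from (underLine⇔ι r s 1 3)))
                    (ℚ.≰⇒> (¬x1 ∘ from (underLine⇔ι r s (suc x) 1))) ⟩
    (ι 1 ℚ.* s ℚ.+ ι 3 ℚ.* r) ℚ.+ (ι (suc x) ℚ.* s ℚ.+ ι 1 ℚ.* r)
      ≡⟨ regroup (ι 1) (ι 3) (ι (suc x)) ⟩
    (ι 1 ℚ.+ ι (suc x)) ℚ.* s ℚ.+ (ι 3 ℚ.+ ι 1) ℚ.* r
      ≡⟨ cong₂ (λ u v → u ℚ.* s ℚ.+ v ℚ.* r) (sym (ι-+ 1 (suc x))) (sym (ι-+ 3 1)) ⟩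
    ι (2 + x) ℚ.* s ℚ.+ ι 4 ℚ.* r
      ≤⟨ ℚ.+-monoˡ-≤ (ι 4 ℚ.* r) (ℚ.*-monoʳ-≤-nonNeg s (ι-mono-≤ 1+x<2y)) ⟩
    ι (2 * y) ℚ.* s ℚ.+ ι 4 ℚ.* r
      ≡⟨ cong₂ (λ u v → u ℚ.* s ℚ.+ v ℚ.* r) (ι-* 2 y) (ι-* 2 2) ⟩
    (ι 2 ℚ.* ι y) ℚ.* s ℚ.+ (ι 2 ℚ.* ι 2) ℚ.* r
      ≡⟨ factor (ι 2) (ι y) ⟩
    ι 2 ℚ.* (ι y ℚ.* s ℚ.+ ι 2 ℚ.* r)
      ≤⟨ ℚ.*-monoˡ-≤-nonNeg (ι 2) (to (underLine⇔ι r s y 2) y2) ⟩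
    ι 2 ℚ.* (r ℚ.* s)
      ≡⟨ double (r ℚ.* s) ⟩
    r ℚ.* s ℚ.+ r ℚ.* s ∎

-- With k = N / (P Q), s = P k and r = Q k one has a s + b r = (P a + Q b) k and r s = N k.
linear-belowLine : ∀ p q n → BelowLine (λ a b → suc p * a + suc q * b ≤ suc n)
linear-belowLine p q n = r , s , 0<r , 0<s , λ a b _ _ → ⇔-sym (scaled a b ⇔-∘ underLine⇔ι r s a b)
  where
  P = suc p
  Q = suc q
  N = suc n
  k = ι N ℚ.* ℚ.1/ ι (P * Q)
  instance
    k-pos : ℚ.Positive k
    k-pos = ℚ.pos*pos⇒pos (ι N) (ℚ.1/ ι (P * Q)) {{ℚ.1/pos⇒pos (ι (P * Q))}}
    k-nonNeg : ℚ.NonNegative k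
    k-nonNeg = ℚ.pos⇒nonNeg k
  s = ι P ℚ.* k
  r = ι Q ℚ.* k
  0<s : 0ℚ ℚ.< s
  0<s = ℚ.positive⁻¹ s {{ℚ.pos*pos⇒pos (ι P) k}}
  0<r : 0ℚ ℚ.< r
  0<r = ℚ.positive⁻¹ r {{ℚ.pos*pos⇒pos (ι Q) k}}
  open ≡-Reasoning
  open ℚ-Solver using (_:+_; _:*_; _:=_; con)
  left : ∀ a b → ι a ℚ.* s ℚ.+ ι b ℚ.* r ≡ ι (P * a + Q * b) ℚ.* k
  left a b = begin
    ι a ℚ.* (ι P ℚ.* k) ℚ.+ ι b ℚ.* (ι Q ℚ.* k)
      ≡⟨ ℚ-Solver.solve 5 (λ a b p q k → a :* (p :* k) :+ b :* (q :* k) := (p :* a :+ q :* b) :* k)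
                          refl (ι a) (ι b) (ι P) (ι Q) k ⟩
    (ι P ℚ.* ι a ℚ.+ ι Q ℚ.* ι b) ℚ.* k
      ≡⟨ cong (ℚ._* k) (sym (trans (ι-+ (P * a) (Q * b)) (cong₂ ℚ._+_ (ι-* P a) (ι-* Q b)))) ⟩
    ι (P * a + Q * b) ℚ.* k ∎
  right : r ℚ.* s ≡ ι N ℚ.* k
  right = begin
    ι Q ℚ.* k ℚ.* (ι P ℚ.* k)
      ≡⟨ ℚ-Solver.solve 3 (λ p q k → q :* k :* (p :* k) := (p :* q :* k) :* k) refl (ι P) (ι Q) k ⟩
    (ι P ℚ.* ι Q ℚ.* k) ℚ.* k
      ≡⟨ cong (λ u → u ℚ.* k ℚ.* k) (sym (ι-* P Q)) ⟩
    (ι (P * Q) ℚ.* (ι N ℚ.* ℚ.1/ ι (P * Q))) ℚ.* k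
      ≡⟨ cong (ℚ._* k) (ℚ-Solver.solve 3 (λ u v w → u :* (v :* w) := v :* (u :* w))
                                         refl (ι (P * Q)) (ι N) (ℚ.1/ ι (P * Q))) ⟩
    (ι N ℚ.* (ι (P * Q) ℚ.* ℚ.1/ ι (P * Q))) ℚ.* k
      ≡⟨ cong (λ u → ι N ℚ.* u ℚ.* k) (ℚ.*-inverseʳ (ι (P * Q))) ⟩
    (ι N ℚ.* ℚ.1ℚ) ℚ.* k
      ≡⟨ cong (ℚ._* k) (ℚ.*-identityʳ (ι N)) ⟩
    ι N ℚ.* k ∎
  scaled : ∀ a b → (ι a ℚ.* s ℚ.+ ι b ℚ.* r ℚ.≤ r ℚ.* s) ⇔ (P * a + Q * b ≤ N)
  scaled a b = mk⇔
    (λ le → ι-cancel-≤ (ℚ.*-cancelʳ-≤-pos k (subst₂ ℚ._≤_ (left a b) right le)))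
    (λ le → subst₂ ℚ._≤_ (sym (left a b)) (sym right) (ℚ.*-monoʳ-≤-nonNeg k (ι-mono-≤ le)))

-- Two-row shapes

Cell : Set
Cell = ℕ × ℕ

data TwoRow (x y : ℕ) : Cell → Set where
  row₁ : ∀ {a} → 1 ≤ a → a ≤ x → TwoRow x y (a , 1)
  row₂ : ∀ {a} → 1 ≤ a → a ≤ y → TwoRow x y (a , 2)

twoRowShape : ℕ → ℕ → List ℕ
twoRowShape x zero    = x ∷ []
twoRowShape x (suc y) = x ∷ suc y ∷ []

twoRow⇔diagram : ∀ x y c → TwoRow x y c ⇔ InDiagram (x ∷ y ∷ []) c
twoRow⇔diagram x y c = mk⇔ into back
  where
  into : ∀ {c} → TwoRow x y c → InDiagram (x ∷ y ∷ []) c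
  into (row₁ 1≤a a≤x) = 1≤a , s≤s z≤n , s≤s z≤n , a≤x
  into (row₂ 1≤a a≤y) = 1≤a , s≤s z≤n , s≤s (s≤s z≤n) , a≤y
  back : ∀ {c} → InDiagram (x ∷ y ∷ []) c → TwoRow x y c
  back {a , 1} (1≤a , _ , _ , a≤x) = row₁ 1≤a a≤x
  back {a , 2} (1≤a , _ , _ , a≤y) = row₂ 1≤a a≤y
  back {a , suc (suc (suc _))} (_ , _ , s≤s (s≤s ()) , _)

twoRow⇔shapeDiagram : ∀ x y c → TwoRow x y c ⇔ InDiagram (twoRowShape x y) c
twoRow⇔shapeDiagram x (suc y) c = twoRow⇔diagram x (suc y) c
twoRow⇔shapeDiagram x zero c = mk⇔ into back
  where
  into : ∀ {c} → TwoRow x 0 c → InDiagram (x ∷ []) c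
  into (row₁ 1≤a a≤x) = 1≤a , s≤s z≤n , s≤s z≤n , a≤x
  into (row₂ (s≤s _) ())
  back : ∀ {c} → InDiagram (x ∷ []) c → TwoRow x 0 c
  back {a , 1} (1≤a , _ , _ , a≤x) = row₁ 1≤a a≤x
  back {a , suc (suc _)} (_ , _ , s≤s () , _)

twoRowShape-partition : ∀ {x y} → 1 ≤ x → y ≤ x → IsPartition (twoRowShape x y)
twoRowShape-partition {y = zero}  1≤x _   = 1≤x All.∷ All.[] , Linked.[-]
twoRowShape-partition {y = suc y} 1≤x y≤x = 1≤x All.∷ s≤s z≤n All.∷ All.[] , y≤x Linked.∷ Linked.[-]

IsTriangularSet : (Cell → Set) → Set
IsTriangularSet P = Σ (List ℕ) λ μ → IsTriangularPartition μ × (∀ c → P c ⇔ InDiagram μ c)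

triangularSet⇒belowLine : ∀ {P} → IsTriangularSet P → BelowLine (λ a b → P (a , b))
triangularSet⇒belowLine (_ , (_ , tri) , P⇔μ) = belowLine-cong (λ a b _ _ → ⇔-sym (P⇔μ (a , b))) tri

twoRow-belowLine⇒2y≤1+x : ∀ {x y} → BelowLine (λ a b → TwoRow x y (a , b)) → 2 * y ≤ suc x
twoRow-belowLine⇒2y≤1+x {y = zero} _ = z≤n
twoRow-belowLine⇒2y≤1+x {x} {suc y} (r , s , _ , 0<s , line) = underLine⇒2y≤1+x {r} {s} x (suc y) 0<s
  (to (line (suc y) 2 (s≤s z≤n) (s≤s z≤n)) (row₂ (s≤s z≤n) ℕ.≤-refl))
  (λ under → case from (line 1 3 (s≤s z≤n) (s≤s z≤n)) under of λ ())
  (λ under → case from (line (suc x) 1 (s≤s z≤n) (s≤s z≤n)) under of λ { (row₁ _ 1+x≤x) → ℕ.1+n≰n 1+x≤x })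

m+n≤m+o⇔n≤o : ∀ m {n o} → (m + n ≤ m + o) ⇔ (n ≤ o)
m+n≤m+o⇔n≤o m = mk⇔ (ℕ.+-cancelˡ-≤ m _ _) (ℕ.+-monoʳ-≤ m)

2*a≤2*m⇔a≤m : ∀ {a m} → (2 * a ≤ 2 * m) ⇔ (a ≤ m)
2*a≤2*m⇔a≤m = mk⇔ (ℕ.*-cancelˡ-≤ 2) (ℕ.*-monoʳ-≤ 2)

2*a≤1+2*m⇔a≤m : ∀ {a m} → (2 * a ≤ suc (2 * m)) ⇔ (a ≤ m)
2*a≤1+2*m⇔a≤m {a} {m} = mk⇔
  (λ le → s≤s⁻¹ (ℕ.*-cancelˡ-< 2 a (suc m) (subst (suc (2 * a) ≤_) (sym (ℕ.*-suc 2 m)) (s≤s le))))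
  (λ le → ℕ.m≤n⇒m≤1+n (ℕ.*-monoʳ-≤ 2 le))

-- Row 1 of the half-plane ends at y + t, row 2 at y, and row 3 is empty exactly when y ≤ t + 1.
twoRow⇔linear : ∀ {y t a} b → 1 ≤ a → 1 ≤ b → y ≤ suc t →
                TwoRow (y + t) y (a , b) ⇔ (2 * a + suc (2 * t) * b ≤ suc (2 * y + 4 * t + 1))
twoRow⇔linear {y} {t} {a} 1 1≤a _ _ = mk⇔ (λ { (row₁ _ a≤x) → from linear a≤x }) (row₁ 1≤a ∘ to linear)
  where
  lhs : ∀ a t → suc (2 * t) + 2 * a ≡ 2 * a + suc (2 * t) * 1
  lhs = solve-∀
  rhs : ∀ y t → suc (2 * t) + suc (2 * (y + t)) ≡ suc (2 * y + 4 * t + 1)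
  rhs = solve-∀
  linear : (2 * a + suc (2 * t) * 1 ≤ suc (2 * y + 4 * t + 1)) ⇔ (a ≤ y + t)
  linear = subst₂ (λ u v → (u ≤ v) ⇔ (a ≤ y + t)) (lhs a t) (rhs y t)
                  (2*a≤1+2*m⇔a≤m ⇔-∘ m+n≤m+o⇔n≤o (suc (2 * t)))
twoRow⇔linear {y} {t} {a} 2 1≤a _ _ = mk⇔ (λ { (row₂ _ a≤y) → from linear a≤y }) (row₂ 1≤a ∘ to linear)
  where
  lhs : ∀ a t → 4 * t + 2 + 2 * a ≡ 2 * a + suc (2 * t) * 2
  lhs = solve-∀
  rhs : ∀ y t → 4 * t + 2 + 2 * y ≡ suc (2 * y + 4 * t + 1)
  rhs = solve-∀
  linear : (2 * a + suc (2 * t) * 2 ≤ suc (2 * y + 4 * t + 1)) ⇔ (a ≤ y)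
  linear = subst₂ (λ u v → (u ≤ v) ⇔ (a ≤ y)) (lhs a t) (rhs y t)
                  (2*a≤2*m⇔a≤m ⇔-∘ m+n≤m+o⇔n≤o (4 * t + 2))
twoRow⇔linear {y} {t} {a} (suc (suc (suc j))) 1≤a _ y≤1+t = mk⇔ (λ ()) (⊥-elim ∘ ℕ.<⇒≱ too-far)
  where
  open ℕ.≤-Reasoning
  too-far : suc (2 * y + 4 * t + 1) < 2 * a + suc (2 * t) * suc (suc (suc j))
  too-far = begin-strict
    suc (2 * y + 4 * t + 1)        ≡⟨ solve (y ∷ t ∷ []) ⟩
    2 * y + 4 * t + 2              ≤⟨ ℕ.+-monoˡ-≤ 2 (ℕ.+-monoˡ-≤ (4 * t) (ℕ.*-monoʳ-≤ 2 y≤1+t)) ⟩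
    2 * suc t + 4 * t + 2          <⟨ ℕ.n<1+n _ ⟩
    suc (2 * suc t + 4 * t + 2)    ≡⟨ solve (t ∷ []) ⟩
    2 * 1 + suc (2 * t) * 3        ≤⟨ ℕ.+-mono-≤ (ℕ.*-monoʳ-≤ 2 1≤a) (ℕ.*-monoʳ-≤ (suc (2 * t)) (ℕ.m≤m+n 3 j)) ⟩
    2 * a + suc (2 * t) * (3 + j)  ∎

2[1+y]≰1 : ∀ {y} → ¬ 2 * suc y ≤ 1
2[1+y]≰1 {y} = ℕ.<⇒≱ (ℕ.*-monoʳ-≤ 2 {1} {suc y} (s≤s z≤n))

2y≤1+x⇒y≤x : ∀ {x y} → 2 * y ≤ suc x → y ≤ x
2y≤1+x⇒y≤x {y = zero}      _      = z≤n
2y≤1+x⇒y≤x {x} {y = suc y} 2y≤1+x = ℕ.≤-trans (ℕ.m≤m+n (suc y) y) (s≤s⁻¹ (subst (_≤ suc x) 2[1+y]≡2+y+y 2y≤1+x))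
  where
  2[1+y]≡2+y+y : 2 * suc y ≡ suc (suc y + y)
  2[1+y]≡2+y+y = solve (y ∷ [])

2y≤1+x⇒twoRow-belowLine : ∀ {x y} → 2 * y ≤ suc x → BelowLine (λ a b → TwoRow x y (a , b))
2y≤1+x⇒twoRow-belowLine {x} {y} 2y≤1+x with x ℕ.∸ y | ℕ.m+[n∸m]≡n {y} {x} (2y≤1+x⇒y≤x 2y≤1+x)
... | t | refl = belowLine-cong (λ a b 1≤a 1≤b → ⇔-sym (twoRow⇔linear b 1≤a 1≤b y≤1+t))
                                (linear-belowLine 1 (2 * t) (2 * y + 4 * t + 1))
  where
  y≤1+t : y ≤ suc t
  y≤1+t = ℕ.+-cancelˡ-≤ y y (suc t) (subst₂ _≤_ (cong (y ℕ.+_) (ℕ.+-identityʳ y)) (sym (ℕ.+-suc y t)) 2y≤1+x)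

2y≤1+x⇒twoRow-triangular : ∀ {x y} → 1 ≤ x → 2 * y ≤ suc x → IsTriangularSet (TwoRow x y)
2y≤1+x⇒twoRow-triangular {x} {y} 1≤x 2y≤1+x =
  twoRowShape x y ,
  (twoRowShape-partition 1≤x (2y≤1+x⇒y≤x 2y≤1+x) ,
   belowLine-cong (λ a b _ _ → twoRow⇔shapeDiagram x y (a , b)) (2y≤1+x⇒twoRow-belowLine 2y≤1+x)) ,
  twoRow⇔shapeDiagram x y

-- Fillings whose prefixes are triangular

module _ {A : Set} where

  take-∷ʳ : ∀ {i} (xs : List A) {x} → i ≤ length xs → take i (xs ∷ʳ x) ≡ take i xs
  take-∷ʳ {zero}  _        _         = refl
  take-∷ʳ {suc i} (y ∷ xs) (s≤s i≤n) = cong (y ∷_) (take-∷ʳ xs i≤n)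

  length-∷ʳ : ∀ (xs : List A) {x} → length (xs ∷ʳ x) ≡ suc (length xs)
  length-∷ʳ xs = trans (List.length-++ xs) (ℕ.+-comm (length xs) 1)

  take-length-∷ʳ : ∀ (xs : List A) {x} → take (length xs) (xs ∷ʳ x) ≡ xs
  take-length-∷ʳ xs = trans (take-∷ʳ xs ℕ.≤-refl) (List.take-all (length xs) xs ℕ.≤-refl)

  ∈-take-all : ∀ {i} {xs : List A} {x} → length xs ≤ i → (x ∈ take i xs) ⇔ (x ∈ xs)
  ∈-take-all {i} {xs} {x} n≤i = subst (λ ys → (x ∈ ys) ⇔ (x ∈ xs)) (sym (List.take-all i xs n≤i)) (⇔-id _)

  ∈-∷ʳ⇔ : ∀ {xs : List A} {x y} → (y ∈ xs ∷ʳ x) ⇔ (y ∈ xs ⊎ y ≡ x)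
  ∈-∷ʳ⇔ {xs} = mk⇔ (Sum.map₂ (λ { (here y≡x) → y≡x }) ∘ ∈-++⁻ xs)
                   [ ∈-++⁺ˡ , (λ { refl → ∈-++⁺ʳ xs (here refl) }) ]

  unique-∷ʳ⁺ : ∀ {xs : List A} {x} → Unique xs → x ∉ xs → Unique (xs ∷ʳ x)
  unique-∷ʳ⁺ uniq x∉xs = Unique.++⁺ uniq (All.[] AllPairs.∷ AllPairs.[]) λ { (x∈xs , here refl) → x∉xs x∈xs }

  unique-∷ʳ⁻ : ∀ (xs : List A) {x} → Unique (xs ∷ʳ x) → Unique xs × x ∉ xs
  unique-∷ʳ⁻ []       _                  = AllPairs.[] , λ ()
  unique-∷ʳ⁻ (y ∷ xs) (y∉xs∷ʳx AllPairs.∷ uniq) with unique-∷ʳ⁻ xs uniq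
  ... | uniq′ , x∉xs = All.++⁻ˡ xs y∉xs∷ʳx AllPairs.∷ uniq′ , λ
    { (here refl) → All.lookup y∉xs∷ʳx (∈-++⁺ʳ xs (here refl)) refl
    ; (there x∈xs) → x∉xs x∈xs
    }

-- IsTriangularTableau τ is TriangularFilling (sum τ) (InDiagram τ) by definition.
TriangularFilling : ℕ → (Cell → Set) → List Cell → Set
TriangularFilling n P cs =
  length cs ≡ n × Unique cs × (∀ c → (c ∈ cs) ⇔ P c) ×
  (∀ i → 1 ≤ i → i ≤ n → IsTriangularSet (_∈ take i cs))

Adds : Cell → (Cell → Set) → (Cell → Set) → Set
Adds c P P⁺ = ¬ P c × (∀ d → P⁺ d ⇔ (P d ⊎ d ≡ c))

triangularSet-leftClosed : ∀ {P a a′ b} → IsTriangularSet P → 1 ≤ a → a ≤ a′ → P (a′ , b) → P (a , b)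
triangularSet-leftClosed (_ , _ , P⇔μ) 1≤a a≤a′ Pa′b with to (P⇔μ _) Pa′b
... | _ , 1≤b , b≤k , a′≤μb = from (P⇔μ _) (1≤a , 1≤b , b≤k , ℕ.≤-trans a≤a′ a′≤μb)

filling-cong : ∀ {n n′ P Q cs} → n ≡ n′ → (∀ c → P c ⇔ Q c) → TriangularFilling n P cs → TriangularFilling n′ Q cs
filling-cong refl P⇔Q (len , uniq , mem , pre) = len , uniq , (λ c → P⇔Q c ⇔-∘ mem c) , pre

filling⇒triangular : ∀ {n P cs} → TriangularFilling n P cs → 1 ≤ n → IsTriangularSet P
filling⇒triangular {n} (len , _ , mem , pre) 1≤n with pre n 1≤n ℕ.≤-refl
... | μ , tp , prefix⇔μ =
  μ , tp , λ c → prefix⇔μ c ⇔-∘ (⇔-sym (∈-take-all (ℕ.≤-reflexive len)) ⇔-∘ ⇔-sym (mem c))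

filling-∷ʳ⁺ : ∀ {n c P P⁺ cs} → Adds c P P⁺ → IsTriangularSet P⁺ →
              TriangularFilling n P cs → TriangularFilling (suc n) P⁺ (cs ∷ʳ c)
filling-∷ʳ⁺ {n} {c} {P⁺ = P⁺} {cs} (c∉P , P⁺⇔) (μ , tp , P⁺⇔μ) (len , uniq , mem , pre) =
  len⁺ , unique-∷ʳ⁺ uniq (c∉P ∘ to (mem c)) , mem⁺ , pre⁺
  where
  len⁺ : length (cs ∷ʳ c) ≡ suc n
  len⁺ = trans (length-∷ʳ cs) (cong suc len)
  mem⁺ : ∀ d → (d ∈ cs ∷ʳ c) ⇔ P⁺ d
  mem⁺ d = ⇔-sym (P⁺⇔ d) ⇔-∘ ((mem d ⊎-⇔ ⇔-id _) ⇔-∘ ∈-∷ʳ⇔)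
  pre⁺ : ∀ i → 1 ≤ i → i ≤ suc n → IsTriangularSet (_∈ take i (cs ∷ʳ c))
  pre⁺ i 1≤i i≤1+n with i ℕ.≤? n
  ... | yes i≤n = subst (λ ys → IsTriangularSet (_∈ ys)) (sym (take-∷ʳ cs (subst (i ≤_) (sym len) i≤n))) (pre i 1≤i i≤n)
  ... | no  i≰n = μ , tp , λ d → P⁺⇔μ d ⇔-∘ (mem⁺ d ⇔-∘ ∈-take-all (subst (_≤ i) (sym len⁺) (ℕ.≰⇒> i≰n)))

filling-∷ʳ⁻ : ∀ {n c P P⁺ cs} → Adds c P P⁺ → TriangularFilling (suc n) P⁺ (cs ∷ʳ c) → TriangularFilling n P cs
filling-∷ʳ⁻ {n} {c} {P} {cs = cs} (c∉P , P⁺⇔) (len , uniq , mem , pre) = len⁻ , uniq⁻ , mem⁻ , pre⁻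
  where
  uniq⁻ = proj₁ (unique-∷ʳ⁻ cs uniq)
  c∉cs = proj₂ (unique-∷ʳ⁻ cs uniq)
  len⁻ : length cs ≡ n
  len⁻ = ℕ.suc-injective (trans (sym (length-∷ʳ cs)) len)
  mem⁻ : ∀ d → (d ∈ cs) ⇔ P d
  mem⁻ d = mk⇔
    (λ d∈cs → [ (λ Pd → Pd) , (λ { refl → ⊥-elim (c∉cs d∈cs) }) ]
                (to (P⁺⇔ d) (to (mem d) (∈-++⁺ˡ d∈cs))))
    (λ Pd → [ (λ d∈cs → d∈cs) , (λ { refl → ⊥-elim (c∉P Pd) }) ]
              (to ∈-∷ʳ⇔ (from (mem d) (from (P⁺⇔ d) (inj₁ Pd)))))
  pre⁻ : ∀ i → 1 ≤ i → i ≤ n → IsTriangularSet (_∈ take i cs)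
  pre⁻ i 1≤i i≤n = subst (λ ys → IsTriangularSet (_∈ ys)) (take-∷ʳ cs (subst (i ≤_) (sym len⁻) i≤n))
                         (pre i 1≤i (ℕ.m≤n⇒m≤1+n i≤n))

-- The cells before the last one form a Ferrers diagram, so a cell of P right of the last cell
-- would drag the last cell into that prefix.
filling-last-rightmost : ∀ {n P cs a b a′} → TriangularFilling n P (cs ∷ʳ (a , b)) → P (a′ , b) → a′ ≤ a
filling-last-rightmost {n} {cs = cs} {a} {b} {a′} filling@(len , uniq , mem , pre) Pa′b
  with to ∈-∷ʳ⇔ (from (mem (a′ , b)) Pa′b)
... | inj₂ refl    = ℕ.≤-refl
... | inj₁ a′b∈cs = ℕ.≮⇒≥ λ a<a′ →
  proj₂ (unique-∷ʳ⁻ cs uniq) (triangularSet-leftClosed prefix 1≤a (ℕ.<⇒≤ a<a′) a′b∈cs)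
  where
  1+∣cs∣≡n : suc (length cs) ≡ n
  1+∣cs∣≡n = trans (sym (length-∷ʳ cs)) len
  prefix : IsTriangularSet (_∈ cs)
  prefix = subst (λ ys → IsTriangularSet (_∈ ys)) (take-length-∷ʳ cs)
                 (pre (length cs) (∈-length a′b∈cs) (subst (length cs ≤_) 1+∣cs∣≡n (ℕ.n≤1+n _)))
  1≤a : 1 ≤ a
  1≤a with filling⇒triangular filling (subst (1 ≤_) 1+∣cs∣≡n (s≤s z≤n))
  ... | _ , _ , P⇔μ = proj₁ (to (P⇔μ (a , b)) (to (mem (a , b)) (from ∈-∷ʳ⇔ (inj₂ refl))))

-- Binomial coefficients and ballot numbers

-- (k + 1) C(n, k + 1) = (n − k) C(n, k), in the subtraction-free form that Pascal's rule propagates.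
[1+k]*nC[1+k]+k*nCk≡n*nCk : ∀ n k → suc k * (n C suc k) + k * (n C k) ≡ n * (n C k)
[1+k]*nC[1+k]+k*nCk≡n*nCk zero    zero    = refl
[1+k]*nC[1+k]+k*nCk≡n*nCk zero    (suc k) = cong₂ _+_ (ℕ.*-zeroʳ (suc (suc k))) (ℕ.*-zeroʳ (suc k))
[1+k]*nC[1+k]+k*nCk≡n*nCk (suc n) zero    = begin
  1 * (suc n C 1) + 0  ≡⟨ cong (λ c → 1 * c + 0) (nC1≡n (suc n)) ⟩
  1 * suc n + 0        ≡⟨ solve (n ∷ []) ⟩
  suc n * 1            ∎
  where open ≡-Reasoning
[1+k]*nC[1+k]+k*nCk≡n*nCk (suc n) (suc k) = begin
  suc (suc k) * (suc n C suc (suc k)) + suc k * (suc n C suc k)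
    ≡⟨ cong₂ (λ u v → suc (suc k) * u + suc k * v) (sym (nCk+nC[k+1]≡[n+1]C[k+1] n (suc k))) (sym pascal) ⟩
  suc (suc k) * (b + c) + suc k * (a + b)
    ≡⟨ regroup a b c k ⟩
  (suc (suc k) * c + suc k * b) + (suc k * b + k * a) + (a + b)
    ≡⟨ cong₂ (λ u v → u + v + (a + b)) ([1+k]*nC[1+k]+k*nCk≡n*nCk n (suc k)) ([1+k]*nC[1+k]+k*nCk≡n*nCk n k) ⟩
  n * b + n * a + (a + b)
    ≡⟨ collect a b n ⟩
  suc n * (a + b)
    ≡⟨ cong (suc n *_) pascal ⟩
  suc n * (suc n C suc k) ∎
  where
  open ≡-Reasoning
  a = n C k
  b = n C suc k
  c = n C suc (suc k)
  pascal : a + b ≡ suc n C suc k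
  pascal = nCk+nC[k+1]≡[n+1]C[k+1] n k
  regroup : ∀ a b c k → suc (suc k) * (b + c) + suc k * (a + b) ≡ (suc (suc k) * c + suc k * b) + (suc k * b + k * a) + (a + b)
  regroup = solve-∀
  collect : ∀ a b n → n * b + n * a + (a + b) ≡ suc n * (a + b)
  collect = solve-∀

[1+k]*[m+k]C[1+k]≡m*[m+k]Ck : ∀ m k → suc k * ((m + k) C suc k) ≡ m * ((m + k) C k)
[1+k]*[m+k]C[1+k]≡m*[m+k]Ck m k = ℕ.+-cancelʳ-≡ (k * ((m + k) C k)) _ _
  (trans ([1+k]*nC[1+k]+k*nCk≡n*nCk (m + k) k) (ℕ.*-distribʳ-+ ((m + k) C k) m k))

-- n C⁻ k stands for C(n, k − 1), read as 0 at k = 0.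
_C⁻_ : ℕ → ℕ → ℕ
n C⁻ zero  = 0
n C⁻ suc k = n C k

C⁻-pascal : ∀ n k → n C⁻ k + n C⁻ suc k ≡ suc n C⁻ suc k
C⁻-pascal n zero    = refl
C⁻-pascal n (suc k) = nCk+nC[k+1]≡[n+1]C[k+1] n k

ballot : ℕ → ℕ → ℤ
ballot x y = + ((x + y + 1) C y) ℤ.- + 2 ℤ.* + ((x + y + 1) C⁻ y)

ballot-pascal : ∀ x y → ballot (suc x) (suc y) ≡ ballot x (suc y) ℤ.+ ballot (suc x) y
ballot-pascal x y = begin
  + (suc n C suc y) ℤ.- + 2 ℤ.* + (suc n C⁻ suc y)
    ≡⟨ cong₂ (λ u v → + u ℤ.- + 2 ℤ.* + v) (sym (nCk+nC[k+1]≡[n+1]C[k+1] n y)) (sym (C⁻-pascal n y)) ⟩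
  + (n C y + n C suc y) ℤ.- + 2 ℤ.* + (n C⁻ y + n C⁻ suc y)
    ≡⟨ regroup (+ (n C y)) (+ (n C suc y)) (+ (n C⁻ y)) (+ (n C⁻ suc y)) ⟩
  ballot x (suc y) ℤ.+ (+ (n C y) ℤ.- + 2 ℤ.* + (n C⁻ y))
    ≡⟨ cong (λ m → ballot x (suc y) ℤ.+ (+ (m C y) ℤ.- + 2 ℤ.* + (m C⁻ y))) (cong (_+ 1) (ℕ.+-suc x y)) ⟩
  ballot x (suc y) ℤ.+ ballot (suc x) y ∎
  where
  open ≡-Reasoning
  n = x + suc y + 1
  regroup : ∀ a b c d → (a ℤ.+ b) ℤ.- + 2 ℤ.* (c ℤ.+ d) ≡ (b ℤ.- + 2 ℤ.* d) ℤ.+ (a ℤ.- + 2 ℤ.* c)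
  regroup = ℤ-Solver.solve-∀

ballot-boundary : ∀ k → ballot (2 * k) (suc k) ≡ + 0
ballot-boundary k = begin
  + B ℤ.- + 2 ℤ.* + A      ≡⟨ cong (λ b → + b ℤ.- + 2 ℤ.* + A) B≡2A ⟩
  + (2 * A) ℤ.- + 2 ℤ.* + A ≡⟨ cong (ℤ._- + 2 ℤ.* + A) (ℤ.pos-* 2 A) ⟩
  + 2 ℤ.* + A ℤ.- + 2 ℤ.* + A ≡⟨ ℤ.+-inverseʳ (+ 2 ℤ.* + A) ⟩
  + 0                        ∎
  where
  open ≡-Reasoning
  n = 2 * k + suc k + 1
  A = n C k
  B = n C suc k
  index : ∀ k → 2 * suc k + k ≡ 2 * k + suc k + 1
  index = solve-∀
  swap : ∀ k a → 2 * suc k * a ≡ suc k * (2 * a)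
  swap = solve-∀
  absorbed : suc k * B ≡ 2 * suc k * A
  absorbed = subst (λ m → suc k * (m C suc k) ≡ 2 * suc k * (m C k)) (index k)
                   ([1+k]*[m+k]C[1+k]≡m*[m+k]Ck (2 * suc k) k)
  B≡2A : B ≡ 2 * A
  B≡2A = ℕ.*-cancelˡ-≡ B (2 * A) (suc k) (begin
    suc k * B         ≡⟨ absorbed ⟩
    2 * suc k * A     ≡⟨ swap k A ⟩
    suc k * (2 * A)   ∎)

ballot-closed : ∀ x y → ballot x y ℤ.* + (x + 2) ≡ ((+ x ℤ.- + 2 ℤ.* + y) ℤ.+ + 2) ℤ.* + ((x + y + 1) C y)
ballot-closed x zero = one-row (+ x)
  where
  one-row : ∀ X → (+ 1 ℤ.- + 2 ℤ.* + 0) ℤ.* (X ℤ.+ + 2) ≡ ((X ℤ.- + 2 ℤ.* + 0) ℤ.+ + 2) ℤ.* + 1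
  one-row = ℤ-Solver.solve-∀
ballot-closed x (suc k) = begin
  (+ B ℤ.- + 2 ℤ.* + A) ℤ.* + (x + 2)            ≡⟨ expand (+ B) (+ A) (+ x) ⟩
  + B ℤ.* + (x + 2) ℤ.- + 2 ℤ.* (+ (x + 2) ℤ.* + A) ≡⟨ cong (λ u → + B ℤ.* + (x + 2) ℤ.- + 2 ℤ.* u) absorption ⟩
  + B ℤ.* + (x + 2) ℤ.- + 2 ℤ.* (+ suc k ℤ.* + B)   ≡⟨ collect (+ B) (+ x) (+ suc k) ⟩
  ((+ x ℤ.- + 2 ℤ.* + suc k) ℤ.+ + 2) ℤ.* + B     ∎
  where
  open ≡-Reasoning
  n = x + suc k + 1
  A = n C k
  B = n C suc k
  index : ∀ x k → x + 2 + k ≡ x + suc k + 1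
  index = solve-∀
  absorption : + (x + 2) ℤ.* + A ≡ + suc k ℤ.* + B
  absorption = begin
    + (x + 2) ℤ.* + A ≡⟨ ℤ.pos-* (x + 2) A ⟨
    + ((x + 2) * A)   ≡⟨ cong +_ (subst (λ m → suc k * (m C suc k) ≡ (x + 2) * (m C k)) (index x k)
                                        ([1+k]*[m+k]C[1+k]≡m*[m+k]Ck (x + 2) k)) ⟨
    + (suc k * B)     ≡⟨ ℤ.pos-* (suc k) B ⟩
    + suc k ℤ.* + B   ∎
  expand : ∀ b a X → (b ℤ.- + 2 ℤ.* a) ℤ.* (X ℤ.+ + 2) ≡ b ℤ.* (X ℤ.+ + 2) ℤ.- + 2 ℤ.* ((X ℤ.+ + 2) ℤ.* a)
  expand = ℤ-Solver.solve-∀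
  collect : ∀ b X K → b ℤ.* (X ℤ.+ + 2) ℤ.- + 2 ℤ.* (K ℤ.* b) ≡ ((X ℤ.- + 2 ℤ.* K) ℤ.+ + 2) ℤ.* b
  collect = ℤ-Solver.solve-∀

-- Tableaux of two-row shape

Tableau : ℕ → ℕ → List Cell → Set
Tableau x y = TriangularFilling (x + y) (TwoRow x y)

adds-row₁ : ∀ {x y} → Adds (suc x , 1) (TwoRow x y) (TwoRow (suc x) y)
adds-row₁ {x} {y} = (λ { (row₁ _ 1+x≤x) → ℕ.1+n≰n 1+x≤x }) , λ _ → mk⇔ split join
  where
  split : ∀ {d} → TwoRow (suc x) y d → TwoRow x y d ⊎ d ≡ (suc x , 1)
  split (row₁ 1≤a a≤1+x) = Sum.map (row₁ 1≤a ∘ s≤s⁻¹) (cong (_, 1)) (ℕ.m≤n⇒m<n∨m≡n a≤1+x)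
  split (row₂ 1≤a a≤y)   = inj₁ (row₂ 1≤a a≤y)
  join : ∀ {d} → TwoRow x y d ⊎ d ≡ (suc x , 1) → TwoRow (suc x) y d
  join (inj₁ (row₁ 1≤a a≤x)) = row₁ 1≤a (ℕ.m≤n⇒m≤1+n a≤x)
  join (inj₁ (row₂ 1≤a a≤y)) = row₂ 1≤a a≤y
  join (inj₂ refl)           = row₁ (s≤s z≤n) ℕ.≤-refl

adds-row₂ : ∀ {x y} → Adds (suc y , 2) (TwoRow x y) (TwoRow x (suc y))
adds-row₂ {x} {y} = (λ { (row₂ _ 1+y≤y) → ℕ.1+n≰n 1+y≤y }) , λ _ → mk⇔ split join
  where
  split : ∀ {d} → TwoRow x (suc y) d → TwoRow x y d ⊎ d ≡ (suc y , 2)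
  split (row₁ 1≤a a≤x)   = inj₁ (row₁ 1≤a a≤x)
  split (row₂ 1≤a a≤1+y) = Sum.map (row₂ 1≤a ∘ s≤s⁻¹) (cong (_, 2)) (ℕ.m≤n⇒m<n∨m≡n a≤1+y)
  join : ∀ {d} → TwoRow x y d ⊎ d ≡ (suc y , 2) → TwoRow x (suc y) d
  join (inj₁ (row₁ 1≤a a≤x)) = row₁ 1≤a a≤x
  join (inj₁ (row₂ 1≤a a≤y)) = row₂ 1≤a (ℕ.m≤n⇒m≤1+n a≤y)
  join (inj₂ refl)           = row₂ (s≤s z≤n) ℕ.≤-refl

tableau-∷ʳ₁ : ∀ {x y cs} → 2 * y ≤ 2 + x → Tableau x y cs → Tableau (suc x) y (cs ∷ʳ (suc x , 1))
tableau-∷ʳ₁ 2y≤2+x = filling-∷ʳ⁺ adds-row₁ (2y≤1+x⇒twoRow-triangular (s≤s z≤n) 2y≤2+x)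

tableau-∷ʳ₂ : ∀ {x y cs} → 2 * suc y ≤ suc x → Tableau x y cs → Tableau x (suc y) (cs ∷ʳ (suc y , 2))
tableau-∷ʳ₂ {x} {y} 2y≤1+x =
  filling-cong (sym (ℕ.+-suc x y)) (λ _ → ⇔-id _) ∘ filling-∷ʳ⁺ adds-row₂ (2y≤1+x⇒twoRow-triangular 1≤x 2y≤1+x)
  where
  1≤x : 1 ≤ x
  1≤x = ℕ.≤-trans (s≤s z≤n) (2y≤1+x⇒y≤x 2y≤1+x)

tableau-init₁ : ∀ {x y cs} → Tableau (suc x) y (cs ∷ʳ (suc x , 1)) → Tableau x y cs
tableau-init₁ = filling-∷ʳ⁻ adds-row₁

tableau-init₂ : ∀ {x y cs} → Tableau x (suc y) (cs ∷ʳ (suc y , 2)) → Tableau x y cs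
tableau-init₂ {x} {y} = filling-∷ʳ⁻ adds-row₂ ∘ filling-cong (ℕ.+-suc x y) (λ _ → ⇔-id _)

tableau-∷ʳ⇒2y≤1+x : ∀ {x y cs c} → Tableau x y (cs ∷ʳ c) → 2 * y ≤ suc x
tableau-∷ʳ⇒2y≤1+x {cs = cs} t@(len , _) =
  twoRow-belowLine⇒2y≤1+x (triangularSet⇒belowLine (filling⇒triangular t (subst (1 ≤_) 1+∣cs∣≡x+y (s≤s z≤n))))
  where
  1+∣cs∣≡x+y = trans (sym (length-∷ʳ cs)) len

data RowEnd : ℕ → ℕ → Cell → Set where
  end₁ : ∀ {x y} → RowEnd (suc x) y (suc x , 1)
  end₂ : ∀ {x y} → RowEnd x (suc y) (suc y , 2)

tableau-rowEnd : ∀ {x y cs c} → Tableau x y (cs ∷ʳ c) → RowEnd x y c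
tableau-rowEnd {x} {y} {c = c} t@(_ , _ , mem , _) = rowEnd (to (mem c) (from ∈-∷ʳ⇔ (inj₂ refl)))
  where
  rowEnd : TwoRow x y c → RowEnd x y c
  rowEnd (row₁ {suc _} 1≤a a≤x) with ℕ.≤-antisym a≤x (filling-last-rightmost t (row₁ (ℕ.≤-trans 1≤a a≤x) ℕ.≤-refl))
  ... | refl = end₁
  rowEnd (row₂ {suc _} 1≤a a≤y) with ℕ.≤-antisym a≤y (filling-last-rightmost t (row₂ (ℕ.≤-trans 1≤a a≤y) ℕ.≤-refl))
  ... | refl = end₂

tableaux : ℕ → ℕ → List (List Cell)
tableaux zero    zero    = [] ∷ []
tableaux (suc x) zero    = map (_∷ʳ (suc x , 1)) (tableaux x zero)
tableaux zero    (suc y) = []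
tableaux (suc x) (suc y) with 2 * suc y ℕ.≤? 2 + x
... | yes _ = map (_∷ʳ (suc x , 1)) (tableaux x (suc y)) ++ map (_∷ʳ (suc y , 2)) (tableaux (suc x) y)
... | no  _ = []

tableau-[] : Tableau 0 0 []
tableau-[] = refl , AllPairs.[] , (λ _ → mk⇔ (λ ()) λ { (row₁ (s≤s _) ()) ; (row₂ (s≤s _) ()) }) , λ { _ (s≤s _) () }

tableaux-sound : ∀ x y → All (Tableau x y) (tableaux x y)
tableaux-sound zero    zero    = tableau-[] All.∷ All.[]
tableaux-sound (suc x) zero    = All.map⁺ (All.map (tableau-∷ʳ₁ z≤n) (tableaux-sound x zero))
tableaux-sound zero    (suc y) = All.[]
tableaux-sound (suc x) (suc y) with 2 * suc y ℕ.≤? 2 + x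
... | yes 2y≤2+x = All.++⁺ (All.map⁺ (All.map (tableau-∷ʳ₁ 2y≤2+x) (tableaux-sound x (suc y))))
                           (All.map⁺ (All.map (tableau-∷ʳ₂ 2y≤2+x) (tableaux-sound (suc x) y)))
... | no  _      = All.[]

∈-tableaux-∷ʳ₁ : ∀ {x y cs} → 2 * y ≤ 2 + x → cs ∈ tableaux x y → cs ∷ʳ (suc x , 1) ∈ tableaux (suc x) y
∈-tableaux-∷ʳ₁ {y = zero}      _ cs∈ = ∈-map⁺ _ cs∈
∈-tableaux-∷ʳ₁ {x} {y = suc y} 2y≤2+x cs∈ with 2 * suc y ℕ.≤? 2 + x
... | yes _      = ∈-++⁺ˡ (∈-map⁺ _ cs∈)
... | no 2y≰2+x = contradiction 2y≤2+x 2y≰2+x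

∈-tableaux-∷ʳ₂ : ∀ {x y cs} → 2 * suc y ≤ suc x → cs ∈ tableaux x y → cs ∷ʳ (suc y , 2) ∈ tableaux x (suc y)
∈-tableaux-∷ʳ₂ {zero} 2y≤1 _ = contradiction 2y≤1 2[1+y]≰1
∈-tableaux-∷ʳ₂ {suc x} {y} 2y≤2+x cs∈ with 2 * suc y ℕ.≤? 2 + x
... | yes _      = ∈-++⁺ʳ _ (∈-map⁺ _ cs∈)
... | no 2y≰2+x = contradiction 2y≤2+x 2y≰2+x

tableaux-complete : ∀ {x y cs} → Tableau x y cs → cs ∈ tableaux x y
tableaux-complete {cs = cs} = complete (reverseView cs)
  where
  complete : ∀ {x y cs} → Reverse cs → Tableau x y cs → cs ∈ tableaux x y
  complete {zero}  {zero}  []              _         = here refl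
  complete {suc _}         []              (() , _)
  complete {zero}  {suc _} []              (() , _)
  complete                 (cs ∶ init ∶ʳ c) t with tableau-rowEnd t
  ... | end₁ = ∈-tableaux-∷ʳ₁ (tableau-∷ʳ⇒2y≤1+x t) (complete init (tableau-init₁ t))
  ... | end₂ = ∈-tableaux-∷ʳ₂ (tableau-∷ʳ⇒2y≤1+x t) (complete init (tableau-init₂ t))

map-∷ʳ-disjoint : ∀ {A : Set} {a b : A} {xss yss} → a ≢ b → Disjoint (map (_∷ʳ a) xss) (map (_∷ʳ b) yss)
map-∷ʳ-disjoint a≢b (∈xss , ∈yss) with ∈-map⁻ _ ∈xss | ∈-map⁻ _ ∈yss
... | xs , _ , refl | ys , _ , xs∷ʳa≡ys∷ʳb = a≢b (List.∷ʳ-injectiveʳ xs ys xs∷ʳa≡ys∷ʳb)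

tableaux-unique : ∀ x y → Unique (tableaux x y)
tableaux-unique zero    zero    = All.[] AllPairs.∷ AllPairs.[]
tableaux-unique (suc x) zero    = Unique.map⁺ (List.∷ʳ-injectiveˡ _ _) (tableaux-unique x zero)
tableaux-unique zero    (suc y) = AllPairs.[]
tableaux-unique (suc x) (suc y) with 2 * suc y ℕ.≤? 2 + x
... | yes _ = Unique.++⁺ (Unique.map⁺ (List.∷ʳ-injectiveˡ _ _) (tableaux-unique x (suc y)))
                         (Unique.map⁺ (List.∷ʳ-injectiveˡ _ _) (tableaux-unique (suc x) y))
                         (map-∷ʳ-disjoint λ ())
... | no  _ = AllPairs.[]

tableaux-empty : ∀ x y → ¬ 2 * y ≤ suc x → tableaux x y ≡ []
tableaux-empty x       zero    2y≰1+x = contradiction z≤n 2y≰1+x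
tableaux-empty zero    (suc y) _      = refl
tableaux-empty (suc x) (suc y) 2y≰2+x with 2 * suc y ℕ.≤? 2 + x
... | yes 2y≤2+x = contradiction 2y≤2+x 2y≰2+x
... | no  _      = refl

length-tableaux : ∀ x y → 2 * y ≤ suc x → + length (tableaux x y) ≡ ballot x y
length-tableaux zero    zero    _ = refl
length-tableaux (suc x) zero    _ = trans (cong +_ (List.length-map _ (tableaux x zero))) (length-tableaux x zero z≤n)
length-tableaux zero    (suc y) 2y≤1 = contradiction 2y≤1 2[1+y]≰1
length-tableaux (suc x) (suc y) 2y≤2+x with 2 * suc y ℕ.≤? 2 + x
... | no 2y≰2+x = contradiction 2y≤2+x 2y≰2+x
... | yes _ = begin
  + length (map (_∷ʳ (suc x , 1)) T₁ ++ map (_∷ʳ (suc y , 2)) T₂)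
    ≡⟨ cong +_ (trans (List.length-++ (map _ T₁)) (cong₂ _+_ (List.length-map _ T₁) (List.length-map _ T₂))) ⟩
  + length T₁ ℤ.+ + length T₂
    ≡⟨ cong₂ ℤ._+_ first-column (length-tableaux (suc x) y (ℕ.≤-trans (ℕ.*-monoʳ-≤ 2 (ℕ.n≤1+n y)) 2y≤2+x)) ⟩
  ballot x (suc y) ℤ.+ ballot (suc x) y
    ≡⟨ ballot-pascal x y ⟨
  ballot (suc x) (suc y) ∎
  where
  open ≡-Reasoning
  T₁ = tableaux x (suc y)
  T₂ = tableaux (suc x) y
  first-column : + length T₁ ≡ ballot x (suc y)
  first-column with 2 * suc y ℕ.≤? suc x
  ... | yes 2y≤1+x = length-tableaux x (suc y) 2y≤1+x
  ... | no  2y≰1+x = begin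
    + length T₁             ≡⟨ cong (+_ ∘ length) (tableaux-empty x (suc y) 2y≰1+x) ⟩
    + 0                     ≡⟨ ballot-boundary y ⟨
    ballot (2 * y) (suc y)  ≡⟨ cong (λ z → ballot z (suc y)) 2y≡x ⟩
    ballot x (suc y)        ∎
    where
    2y≡x : 2 * y ≡ x
    2y≡x = ℕ.suc-injective (ℕ.suc-injective (trans (sym (ℕ.*-suc 2 y)) (ℕ.≤-antisym 2y≤2+x (ℕ.≰⇒> 2y≰1+x))))

proposition8p3 : (τ₁ τ₂ : ℕ) → IsTriangularPartition (τ₁ ∷ τ₂ ∷ []) →
    Σ (List (List (ℕ × ℕ))) λ T →
      Unique T ×
      (∀ cs → (cs ∈ T) ⇔ IsTriangularTableau (τ₁ ∷ τ₂ ∷ []) cs) ×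
      (+ length T ℤ.* + (τ₁ Data.Nat.+ 2)
        ≡ ((+ τ₁ ℤ.- + 2 ℤ.* + τ₂) ℤ.+ + 2) ℤ.* + ((τ₁ Data.Nat.+ τ₂ Data.Nat.+ 1) C τ₂))
proposition8p3 τ₁ τ₂ (_ , triangular) = tableaux τ₁ τ₂ , tableaux-unique τ₁ τ₂ , tableaux⇔ , count
  where
  size : τ₁ + τ₂ ≡ sum (τ₁ ∷ τ₂ ∷ [])
  size = cong (τ₁ ℕ.+_) (sym (ℕ.+-identityʳ τ₂))
  diagram⇔twoRow : ∀ c → InDiagram (τ₁ ∷ τ₂ ∷ []) c ⇔ TwoRow τ₁ τ₂ c
  diagram⇔twoRow c = ⇔-sym (twoRow⇔diagram τ₁ τ₂ c)
  tableaux⇔ : ∀ cs → (cs ∈ tableaux τ₁ τ₂) ⇔ IsTriangularTableau (τ₁ ∷ τ₂ ∷ []) cs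
  tableaux⇔ cs = mk⇔ (filling-cong size (twoRow⇔diagram τ₁ τ₂) ∘ All.lookup (tableaux-sound τ₁ τ₂))
                     (tableaux-complete ∘ filling-cong (sym size) diagram⇔twoRow)
  2τ₂≤1+τ₁ : 2 * τ₂ ≤ suc τ₁
  2τ₂≤1+τ₁ = twoRow-belowLine⇒2y≤1+x (belowLine-cong (λ a b _ _ → diagram⇔twoRow (a , b)) triangular)
  count : + length (tableaux τ₁ τ₂) ℤ.* + (τ₁ + 2)
          ≡ ((+ τ₁ ℤ.- + 2 ℤ.* + τ₂) ℤ.+ + 2) ℤ.* + ((τ₁ + τ₂ + 1) C τ₂)
  count = trans (cong (ℤ._* + (τ₁ + 2)) (length-tableaux τ₁ τ₂ 2τ₂≤1+τ₁)) (ballot-closed τ₁ τ₂)
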